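{- Let $(Y,Z)$ be an effectively inseparable pair of r.e. sets, and let $V$ be the theory $\mathsf{J}+\{\Phi_n:n\in Y\}+\{\neg\Phi_n:n\in Z\}$. Then $V$ is $\mathsf{EI}$.
   Context: $\mathsf{J}$ (Janiczak's theory) is the theory in the language with a single binary relation symbol $E$ with axioms: $E$ is an equivalence relation; for each $n$, there is at most one equivalence class of size exactly $n$; for each $n$, there are at least $n$ equivalence classes with at least $n$ elements. $\Phi_n$ is the sentence "there exists an equivalence class of size exactly $n+1$". A pair $(A,B)$ of r.e. sets is effectively inseparable ($\mathsf{EI}$) if there is a recursive function $f(x,y)$ such that for all $i,j$, if $A\subseteq W_i$, $B\subseteq W_j$ and $W_i\cap W_j=\emptyset$ then $f(i,j)\notin W_i\cup W_j$ (here $W_e$ is the $e$-th r.e. set). A theory $T$ is $\mathsf{EI}$ if $(T_P,T_R)$ is $\mathsf{EI}$, where $T_P$ and $T_R$ are the sets of Gödel numbers of sentences provable, resp. refutable, in $T$. -}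

module Defs where

open import Data.Nat using (ℕ; zero; suc; _+_; _*_; _^_)
open import Data.Fin using (Fin; toℕ; _↑ˡ_; _↑ʳ_; _<?_) renaming (zero to fz; suc to fs)
open import Data.Vec using (Vec; []; _∷_)
open import Data.List using (List; []; _∷_; map; concatMap; foldr)
open import Data.List.Membership.Propositional using (_∈_)
open import Data.List.Relation.Unary.All using (All)
open import Data.Maybe using (Maybe; just; nothing; _>>=_)
open import Data.Product using (Σ; ∃; _×_; _,_)
open import Data.Sum using (_⊎_)
open import Data.Empty using (⊥)
open import Relation.Nullary using (¬_; yes; no)
open import Relation.Binary.PropositionalEquality using (_≡_)

data PR : ℕ → Set where
  zeroF : ∀ {n} → PR n
  succF : PR 1
  proj  : ∀ {n} → Fin n → PR n
  comp  : ∀ {m n} → PR m → Vec (PR n) m → PR n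
  prim  : ∀ {n} → PR n → PR (suc (suc n)) → PR (suc n)
  mu    : ∀ {n} → PR (suc n) → PR n

lookupV : ∀ {n} → Vec ℕ n → Fin n → ℕ
lookupV (x ∷ xs) fz = x
lookupV (x ∷ xs) (fs i) = lookupV xs i

mutual
  -- eval k p xs : run p on xs with fuel k (nothing = not (yet) halted)
  eval : ℕ → ∀ {n} → PR n → Vec ℕ n → Maybe ℕ
  eval zero p xs = nothing
  eval (suc k) zeroF xs = just 0
  eval (suc k) succF (x ∷ []) = just (suc x)
  eval (suc k) (proj i) xs = just (lookupV xs i)
  eval (suc k) (comp f gs) xs = evalVec k gs xs >>= eval k f
  eval (suc k) (prim f g) (x ∷ xs) = primLoop k f g x xs
  eval (suc k) (mu g) xs = muLoop k g xs 0

  evalVec : ℕ → ∀ {m n} → Vec (PR n) m → Vec ℕ n → Maybe (Vec ℕ m)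
  evalVec k [] xs = just []
  evalVec k (g ∷ gs) xs =
    eval k g xs >>= λ r → evalVec k gs xs >>= λ rs → just (r ∷ rs)

  primLoop : ℕ → ∀ {n} → PR n → PR (suc (suc n)) → ℕ → Vec ℕ n → Maybe ℕ
  primLoop k f g zero xs = eval k f xs
  primLoop k f g (suc x) xs = primLoop k f g x xs >>= λ r → eval k g (x ∷ r ∷ xs)

  muLoop : ℕ → ∀ {n} → PR (suc n) → Vec ℕ n → ℕ → Maybe ℕ
  muLoop zero g xs y = nothing
  muLoop (suc k) g xs y = muStep k g xs y (eval k g (y ∷ xs))

  muStep : ℕ → ∀ {n} → PR (suc n) → Vec ℕ n → ℕ → Maybe ℕ → Maybe ℕ
  muStep k g xs y nothing = nothing
  muStep k g xs y (just zero) = just y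
  muStep k g xs y (just (suc _)) = muLoop k g xs (suc y)

_⇓_⇒_ : ∀ {n} → PR n → Vec ℕ n → ℕ → Set
p ⇓ xs ⇒ v = ∃ λ k → eval k p xs ≡ just v

W : PR 1 → ℕ → Set
W e x = ∃ λ v → e ⇓ (x ∷ []) ⇒ v

_⊆_ : (ℕ → Set) → (ℕ → Set) → Set
A ⊆ B = ∀ x → A x → B x

Disjoint : (ℕ → Set) → (ℕ → Set) → Set
Disjoint A B = ∀ x → A x → B x → ⊥

⟨_,_⟩ : ℕ → ℕ → ℕ
⟨ a , b ⟩ = (2 ^ a) * suc (2 * b)

mutual
  ⌜_⌝ₚ : ∀ {n} → PR n → ℕ
  ⌜ zeroF ⌝ₚ = ⟨ 0 , 0 ⟩
  ⌜ succF ⌝ₚ = ⟨ 1 , 0 ⟩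
  ⌜ proj i ⌝ₚ = ⟨ 2 , toℕ i ⟩
  ⌜ comp {m} f gs ⌝ₚ = ⟨ 3 , ⟨ m , ⟨ ⌜ f ⌝ₚ , codeVec gs ⟩ ⟩ ⟩
  ⌜ prim f g ⌝ₚ = ⟨ 4 , ⟨ ⌜ f ⌝ₚ , ⌜ g ⌝ₚ ⟩ ⟩
  ⌜ mu g ⌝ₚ = ⟨ 5 , ⌜ g ⌝ₚ ⟩

  codeVec : ∀ {m n} → Vec (PR n) m → ℕ
  codeVec [] = 0
  codeVec (g ∷ gs) = suc ⟨ ⌜ g ⌝ₚ , codeVec gs ⟩

-- Effective inseparability of a pair of sets of naturals, with indices
-- of r.e. sets being (codes of) programs and f total recursive.
EI : (ℕ → Set) → (ℕ → Set) → Set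
EI A B =
  Σ (PR 2) λ F →
    (∀ a b → ∃ λ v → F ⇓ (a ∷ b ∷ []) ⇒ v) ×
    (∀ (i j : PR 1) → A ⊆ W i → B ⊆ W j → Disjoint (W i) (W j) →
       ∀ v → F ⇓ (⌜ i ⌝ₚ ∷ ⌜ j ⌝ₚ ∷ []) ⇒ v → ¬ (W i v ⊎ W j v))

-- Formula n : formulas with free variables among n de Bruijn variables
data Formula (n : ℕ) : Set where
  _≐_  : Fin n → Fin n → Formula n
  E    : Fin n → Fin n → Formula n
  ⊥'   : Formula n
  _⇒_  : Formula n → Formula n → Formula n
  ∀'   : Formula (suc n) → Formula n

Sentence : Set
Sentence = Formula 0

infixr 5 _⇒_

¬' : ∀ {n} → Formula n → Formula n
¬' φ = φ ⇒ ⊥'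

⊤' : ∀ {n} → Formula n
⊤' = ⊥' ⇒ ⊥'

_∧'_ : ∀ {n} → Formula n → Formula n → Formula n
φ ∧' ψ = ¬' (φ ⇒ ¬' ψ)

∃' : ∀ {n} → Formula (suc n) → Formula n
∃' φ = ¬' (∀' (¬' φ))

⋀ : ∀ {n} → List (Formula n) → Formula n
⋀ = foldr _∧'_ ⊤'

ext : ∀ {n m} → (Fin n → Fin m) → Fin (suc n) → Fin (suc m)
ext ρ fz = fz
ext ρ (fs i) = fs (ρ i)

rename : ∀ {n m} → (Fin n → Fin m) → Formula n → Formula m
rename ρ (x ≐ y) = ρ x ≐ ρ y
rename ρ (E x y) = E (ρ x) (ρ y)
rename ρ ⊥' = ⊥'
rename ρ (φ ⇒ ψ) = rename ρ φ ⇒ rename ρ ψ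
rename ρ (∀' φ) = ∀' (rename (ext ρ) φ)

wk : ∀ {n} → Formula n → Formula (suc n)
wk = rename fs

inst : ∀ {n} → Formula (suc n) → Fin n → Formula n
inst {n} φ t = rename σ φ
  where
    σ : Fin (suc n) → Fin n
    σ fz = t
    σ (fs i) = i

-- classical natural deduction with equality (nonempty domains)
infix 3 _⊢_
data _⊢_ {n : ℕ} (Γ : List (Formula n)) : Formula n → Set where
  assum : ∀ {φ} → φ ∈ Γ → Γ ⊢ φ
  ⇒I    : ∀ {φ ψ} → (φ ∷ Γ) ⊢ ψ → Γ ⊢ φ ⇒ ψ
  ⇒E    : ∀ {φ ψ} → Γ ⊢ φ ⇒ ψ → Γ ⊢ φ → Γ ⊢ ψ
  raa   : ∀ {φ} → (¬' φ ∷ Γ) ⊢ ⊥' → Γ ⊢ φ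
  ∀I    : ∀ {φ} → map wk Γ ⊢ φ → Γ ⊢ ∀' φ
  ∀E    : ∀ {φ} → Γ ⊢ ∀' φ → (t : Fin n) → Γ ⊢ inst φ t
  ≐refl : ∀ t → Γ ⊢ t ≐ t
  ≐subst : ∀ {s t} (φ : Formula (suc n)) → Γ ⊢ s ≐ t → Γ ⊢ inst φ s → Γ ⊢ inst φ t
  nonempty : ∀ {φ} → map wk Γ ⊢ wk φ → Γ ⊢ φ

_⊩_ : (Sentence → Set) → Sentence → Set
T ⊩ φ = Σ (List Sentence) λ Γ → All T Γ × (Γ ⊢ φ)

⌜_⌝ : ∀ {n} → Formula n → ℕ
⌜ x ≐ y ⌝ = ⟨ 0 , ⟨ toℕ x , toℕ y ⟩ ⟩
⌜ E x y ⌝ = ⟨ 1 , ⟨ toℕ x , toℕ y ⟩ ⟩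
⌜ ⊥' ⌝ = ⟨ 2 , 0 ⟩
⌜ φ ⇒ ψ ⌝ = ⟨ 3 , ⟨ ⌜ φ ⌝ , ⌜ ψ ⌝ ⟩ ⟩
⌜ ∀' φ ⌝ = ⟨ 4 , ⌜ φ ⌝ ⟩

Prov : (Sentence → Set) → ℕ → Set
Prov T n = Σ Sentence λ φ → (⌜ φ ⌝ ≡ n) × (T ⊩ φ)

Refut : (Sentence → Set) → ℕ → Set
Refut T n = Σ Sentence λ φ → (⌜ φ ⌝ ≡ n) × (T ⊩ ¬' φ)

EIₜ : (Sentence → Set) → Set
EIₜ T = EI (Prov T) (Refut T)

∃^ : ∀ k {m} → Formula (k + m) → Formula m
∃^ zero φ = φ
∃^ (suc k) φ = ∃^ k (∃' φ)

-- for the k fresh variables y_i (i : Fin k) at level k + m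
y : ∀ {k} m → Fin k → Fin (k + m)
y m i = i ↑ˡ m

pairwise : ∀ {k} m → (Fin (k + m) → Fin (k + m) → Formula (k + m)) → Formula (k + m)
pairwise {k} m R = ⋀ (concatMap (λ i → concatMap (λ j → pick i j) all) all)
  where
    all : List (Fin k)
    all = Data.List.allFin k
    pick : Fin k → Fin k → List (Formula (k + m))
    pick i j with i <? j
    ... | yes _ = R (y m i) (y m j) ∷ []
    ... | no _ = []

atLeast : ∀ {m} → ℕ → Fin m → Formula m
atLeast {m} k x =
  ∃^ k (pairwise m (λ a b → ¬' (a ≐ b))
        ∧' ⋀ (map (λ i → E (k ↑ʳ x) (y m i)) (Data.List.allFin k)))

exactly : ∀ {m} → ℕ → Fin m → Formula m
exactly k x = atLeast k x ∧' ¬' (atLeast (suc k) x)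

v0 : ∀ {n} → Fin (suc n)
v0 = fz
v1 : ∀ {n} → Fin (suc (suc n))
v1 = fs fz
v2 : ∀ {n} → Fin (suc (suc (suc n)))
v2 = fs (fs fz)

data JAx : Sentence → Set where
  ax-refl   : JAx (∀' (E v0 v0))
  ax-sym    : JAx (∀' (∀' (E v1 v0 ⇒ E v0 v1)))
  ax-trans  : JAx (∀' (∀' (∀' (E v2 v1 ⇒ E v1 v0 ⇒ E v2 v0))))
  ax-unique : ∀ n → JAx (∀' (∀' ((exactly n v1 ∧' exactly n v0) ⇒ E v1 v0)))
  ax-many   : ∀ n → JAx (∃^ n (pairwise 0 (λ a b → ¬' (E a b))
                              ∧' ⋀ (map (λ i → atLeast n (y 0 i)) (Data.List.allFin n))))

Φ : ℕ → Sentence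
Φ n = ∃' (exactly (suc n) v0)

data VAx (Y Z : ℕ → Set) : Sentence → Set where
  jax : ∀ {φ} → JAx φ → VAx Y Z φ
  pos : ∀ {n} → Y n → VAx Y Z (Φ n)
  neg : ∀ {n} → Z n → VAx Y Z (¬' (Φ n))

-- The total computable map n ↦ ⌜Φ n⌝ sends Y into the axioms of V, hence into V_P, and Z into V_R,
-- since ¬Φ n is an axiom for n ∈ Z. Effective inseparability is inherited along such a reduction g:
-- if W i ⊇ V_P and W j ⊇ V_R are disjoint, then so are their preimages W (i ∘ g) ⊇ Y and W (j ∘ g) ⊇ Z,
-- whose indices are computable from those of i and j; the separating function of (Y, Z) at these
-- indices yields u with g u ∉ W i ∪ W j. Most of the work is to show that
-- n ↦ ⌜Φ n⌝ is partial recursive: the Gödel number of `atLeast k x` is built from the pairing function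
-- by primitive recursions along its quantifier prefix and its iterated conjunctions.

module Submission where

open import Defs

open import Data.Fin using (Fin; toℕ; #_; _↑ˡ_; _↑ʳ_; _<?_) renaming (zero to fz)
open import Data.Fin.Properties using (toℕ-↑ˡ; toℕ-↑ʳ)
open import Data.List using (List; []; _∷_; foldr; applyUpTo; upTo; concatMap; tabulate; allFin)
import Data.List as List
open import Data.List.Properties using (foldr-++; foldr-map; foldr-cong; map-tabulate)
open import Data.List.Relation.Unary.All using ([]; _∷_)
open import Data.List.Relation.Unary.Any using (here)
open import Data.Maybe using (Maybe; just; _>>=_)
open import Data.Maybe.Properties using (just-injective)
open import Data.Nat using (ℕ; zero; suc; _+_; _*_; _^_; _∸_; pred; _≤_; _≤′_; _⊔_; ≤′-refl; ≤′-step)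
open import Data.Nat.Properties
  using (≤⇒≤′; m≤m⊔n; m≤n⊔m; ≤-refl; <⇒≤; +-identityʳ; +-suc; +-∸-assoc; n∸n≡0; m≤n⇒m∸n≡0; ≮⇒≥;
         pred[m∸n]≡m∸[1+n])
open import Data.Product using (∃; _×_; _,_; proj₁; proj₂)
open import Data.Sum using (_⊎_)
import Data.Sum as Sum
open import Data.Vec using (Vec; []; _∷_; map)
open import Data.Vec.N-ary using (_$ⁿ_)
open import Function using (_∘_; id)
open import Relation.Binary.PropositionalEquality
  using (_≡_; refl; sym; trans; cong; cong₂; subst; module ≡-Reasoning)
open import Relation.Nullary using (¬_; yes; no)

-- Fuel monotonicity of the evaluator

infix 4 _⊑_
_⊑_ : {A : Set} → Maybe A → Maybe A → Set
m ⊑ m′ = ∀ {v} → m ≡ just v → m′ ≡ just v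

>>=-mono : {A B : Set} {m m′ : Maybe A} {f g : A → Maybe B} →
           m ⊑ m′ → (∀ x → f x ⊑ g x) → (m >>= f) ⊑ (m′ >>= g)
>>=-mono {m = just x} m⊑m′ f⊑g e rewrite m⊑m′ refl = f⊑g x e

mutual
  eval-⊑-suc : ∀ k {n} (p : PR n) xs → eval k p xs ⊑ eval (suc k) p xs
  eval-⊑-suc zero    p           xs       ()
  eval-⊑-suc (suc k) zeroF       xs       e = e
  eval-⊑-suc (suc k) succF       (x ∷ []) e = e
  eval-⊑-suc (suc k) (proj i)    xs       e = e
  eval-⊑-suc (suc k) (comp f gs) xs       = >>=-mono (evalVec-⊑-suc k gs xs) (λ ys → eval-⊑-suc k f ys)
  eval-⊑-suc (suc k) (prim f g)  (x ∷ xs) = primLoop-⊑-suc k f g x xs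
  eval-⊑-suc (suc k) (mu g)      xs       = muLoop-⊑-suc k g xs 0

  evalVec-⊑-suc : ∀ k {m n} (gs : Vec (PR n) m) xs → evalVec k gs xs ⊑ evalVec (suc k) gs xs
  evalVec-⊑-suc k []       xs e = e
  evalVec-⊑-suc k (g ∷ gs) xs =
    >>=-mono (eval-⊑-suc k g xs) (λ _ → >>=-mono (evalVec-⊑-suc k gs xs) (λ _ e → e))

  primLoop-⊑-suc : ∀ k {n} (f : PR n) g x xs → primLoop k f g x xs ⊑ primLoop (suc k) f g x xs
  primLoop-⊑-suc k f g zero    xs = eval-⊑-suc k f xs
  primLoop-⊑-suc k f g (suc x) xs = >>=-mono (primLoop-⊑-suc k f g x xs) (λ _ → eval-⊑-suc k g _)

  muLoop-⊑-suc : ∀ k {n} (g : PR (suc n)) xs y → muLoop k g xs y ⊑ muLoop (suc k) g xs y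
  muLoop-⊑-suc zero    g xs y ()
  muLoop-⊑-suc (suc k) g xs y = muStep-⊑-suc k g xs y (eval-⊑-suc k g (y ∷ xs))

  muStep-⊑-suc : ∀ k {n} (g : PR (suc n)) xs y {m m′} →
                 m ⊑ m′ → muStep k g xs y m ⊑ muStep (suc k) g xs y m′
  muStep-⊑-suc k g xs y {just zero}    m⊑m′ e rewrite m⊑m′ refl = e
  muStep-⊑-suc k g xs y {just (suc r)} m⊑m′ e rewrite m⊑m′ refl = muLoop-⊑-suc k g xs (suc y) e

⊑-mono : {A : Set} (P : ℕ → Maybe A) → (∀ k → P k ⊑ P (suc k)) → ∀ {k k′} → k ≤ k′ → P k ⊑ P k′
⊑-mono P step k≤k′ = go (≤⇒≤′ k≤k′)
  where
  go : ∀ {k k′} → k ≤′ k′ → P k ⊑ P k′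
  go ≤′-refl      e = e
  go (≤′-step le) e = step _ (go le e)

eval-mono : ∀ {n} (p : PR n) xs {k k′} → k ≤ k′ → eval k p xs ⊑ eval k′ p xs
eval-mono p xs = ⊑-mono (λ k → eval k p xs) (λ k → eval-⊑-suc k p xs)

evalVec-mono : ∀ {m n} (gs : Vec (PR n) m) xs {k k′} → k ≤ k′ → evalVec k gs xs ⊑ evalVec k′ gs xs
evalVec-mono gs xs = ⊑-mono (λ k → evalVec k gs xs) (λ k → evalVec-⊑-suc k gs xs)

primLoop-mono : ∀ {n} (f : PR n) g x xs {k k′} → k ≤ k′ → primLoop k f g x xs ⊑ primLoop k′ f g x xs
primLoop-mono f g x xs = ⊑-mono (λ k → primLoop k f g x xs) (λ k → primLoop-⊑-suc k f g x xs)

⇓-functional : ∀ {n} {p : PR n} {xs a b} → p ⇓ xs ⇒ a → p ⇓ xs ⇒ b → a ≡ b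
⇓-functional {p = p} {xs} (k , e) (k′ , e′) =
  just-injective (trans (sym (eval-mono p xs (m≤m⊔n k k′) e)) (eval-mono p xs (m≤n⊔m k k′) e′))

_⇓*_⇒_ : ∀ {m n} → Vec (PR n) m → Vec ℕ n → Vec ℕ m → Set
gs ⇓* xs ⇒ ys = ∃ λ k → evalVec k gs xs ≡ just ys

[]-⇓* : ∀ {n} (xs : Vec ℕ n) → [] ⇓* xs ⇒ []
[]-⇓* xs = 0 , refl

∷-⇓* : ∀ {m n} {g : PR n} {gs : Vec (PR n) m} {xs y ys} →
       g ⇓ xs ⇒ y → gs ⇓* xs ⇒ ys → (g ∷ gs) ⇓* xs ⇒ (y ∷ ys)
∷-⇓* {g = g} {gs} {xs} {y} {ys} (k , e) (k′ , e′) = k ⊔ k′ , run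
  where
  run : evalVec (k ⊔ k′) (g ∷ gs) xs ≡ just (y ∷ ys)
  run rewrite eval-mono g xs (m≤m⊔n k k′) e | evalVec-mono gs xs (m≤n⊔m k k′) e′ = refl

[-]-⇓*⁻¹ : ∀ {n} {g : PR n} {xs y} → (g ∷ []) ⇓* xs ⇒ (y ∷ []) → g ⇓ xs ⇒ y
[-]-⇓*⁻¹ {g = g} {xs} (k , e) with eval k g xs in eq
[-]-⇓*⁻¹ (k , refl) | just _ = k , eq

comp-⇓ : ∀ {m n} {f : PR m} {gs : Vec (PR n) m} {xs ys v} →
         gs ⇓* xs ⇒ ys → f ⇓ ys ⇒ v → comp f gs ⇓ xs ⇒ v
comp-⇓ {f = f} {gs} {xs} {ys} {v} (k , e) (k′ , e′) = suc (k ⊔ k′) , run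
  where
  run : eval (suc (k ⊔ k′)) (comp f gs) xs ≡ just v
  run rewrite evalVec-mono gs xs (m≤m⊔n k k′) e = eval-mono f ys (m≤n⊔m k k′) e′

comp-⇓⁻¹ : ∀ {m n} {f : PR m} {gs : Vec (PR n) m} {xs v} →
           comp f gs ⇓ xs ⇒ v → ∃ λ ys → gs ⇓* xs ⇒ ys × f ⇓ ys ⇒ v
comp-⇓⁻¹ {gs = gs} {xs} (suc k , e) with evalVec k gs xs in eq
... | just ys = ys , (k , eq) , (k , e)

-- Computable functions

record Computable (n : ℕ) (f : Vec ℕ n → ℕ) : Set where
  constructor computable
  field
    program  : PR n
    computes : ∀ xs → program ⇓ xs ⇒ f xs
open Computable public

data Computables {n : ℕ} : ∀ {m} → Vec (Vec ℕ n → ℕ) m → Set where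
  []  : Computables []
  _∷_ : ∀ {m f} {fs : Vec (Vec ℕ n → ℕ) m} → Computable n f → Computables fs → Computables (f ∷ fs)

programs : ∀ {n m} {fs : Vec (Vec ℕ n → ℕ) m} → Computables fs → Vec (PR n) m
programs []       = []
programs (c ∷ cs) = program c ∷ programs cs

programs-⇓* : ∀ {n m} {fs : Vec (Vec ℕ n → ℕ) m} (cs : Computables fs) xs →
              programs cs ⇓* xs ⇒ map (λ f → f xs) fs
programs-⇓* []       xs = []-⇓* xs
programs-⇓* (c ∷ cs) xs = ∷-⇓* {gs = programs cs} (computes c xs) (programs-⇓* cs xs)

compose : ∀ {m n} {g : Vec ℕ m → ℕ} {fs : Vec (Vec ℕ n → ℕ) m} →
          Computable m g → Computables fs → Computable n (λ xs → g (map (λ f → f xs) fs))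
compose c cs = computable (comp (program c) (programs cs))
  (λ xs → comp-⇓ (programs-⇓* cs xs) (computes c _))

computable-≗ : ∀ {n} {f g : Vec ℕ n → ℕ} → Computable n f → (∀ xs → f xs ≡ g xs) → Computable n g
computable-≗ c f≗g = computable (program c) (λ xs → subst (program c ⇓ xs ⇒_) (f≗g xs) (computes c xs))

primRec : ∀ {n} {f : Vec ℕ n → ℕ} {g : Vec ℕ (suc (suc n)) → ℕ} (h : Vec ℕ (suc n) → ℕ) →
          Computable n f → Computable (suc (suc n)) g →
          (∀ xs → h (0 ∷ xs) ≡ f xs) → (∀ x xs → h (suc x ∷ xs) ≡ g (x ∷ h (x ∷ xs) ∷ xs)) →
          Computable (suc n) h
primRec h cf cg h-zero h-suc =
  computable (prim (program cf) (program cg)) (λ { (x ∷ xs) → let k , e = loop x xs in suc k , e })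
  where
  loop : ∀ x xs → ∃ λ k → primLoop k (program cf) (program cg) x xs ≡ just (h (x ∷ xs))
  loop zero xs = subst (λ v → ∃ λ k → eval k (program cf) xs ≡ just v) (sym (h-zero xs)) (computes cf xs)
  loop (suc x) xs with loop x xs | computes cg (x ∷ h (x ∷ xs) ∷ xs)
  ... | k , e | k′ , e′ = k ⊔ k′ , run
    where
    run : primLoop (k ⊔ k′) (program cf) (program cg) (suc x) xs ≡ just (h (suc x ∷ xs))
    run rewrite primLoop-mono (program cf) (program cg) x xs (m≤m⊔n k k′) e | h-suc x xs =
      eval-mono (program cg) _ (m≤n⊔m k k′) e′

compose₁ : ∀ {n a} {f : ℕ → ℕ} → Computable 1 (f $ⁿ_) → Computable n a → Computable n (λ xs → f (a xs))
compose₁ cf ca = compose cf (ca ∷ [])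

compose₂ : ∀ {n a b} {f : ℕ → ℕ → ℕ} → Computable 2 (f $ⁿ_) →
           Computable n a → Computable n b → Computable n (λ xs → f (a xs) (b xs))
compose₂ cf ca cb = compose cf (ca ∷ cb ∷ [])

compose₃ : ∀ {n a b c} {f : ℕ → ℕ → ℕ → ℕ} → Computable 3 (f $ⁿ_) →
           Computable n a → Computable n b → Computable n c → Computable n (λ xs → f (a xs) (b xs) (c xs))
compose₃ cf ca cb cc = compose cf (ca ∷ cb ∷ cc ∷ [])

suc-computable : Computable 1 (suc $ⁿ_)
suc-computable = computable succF (λ { (x ∷ []) → 1 , refl })

π : ∀ {n} (i : Fin n) → Computable n (λ xs → lookupV xs i)
π i = computable (proj i) (λ _ → 1 , refl)

const-computable : ∀ {n} c → Computable n (λ _ → c)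
const-computable zero    = computable zeroF (λ _ → 1 , refl)
const-computable (suc c) = compose₁ suc-computable (const-computable c)

uncurry-computable₁ : {f : ℕ → ℕ} → Computable 1 (λ xs → f (lookupV xs fz)) → Computable 1 (f $ⁿ_)
uncurry-computable₁ c = computable-≗ c λ { (x ∷ []) → refl }

uncurry-computable₂ : {f : ℕ → ℕ → ℕ} →
  Computable 2 (λ xs → f (lookupV xs fz) (lookupV xs (# 1))) → Computable 2 (f $ⁿ_)
uncurry-computable₂ c = computable-≗ c λ { (x ∷ y ∷ []) → refl }

uncurry-computable₃ : {f : ℕ → ℕ → ℕ → ℕ} →
  Computable 3 (λ xs → f (lookupV xs fz) (lookupV xs (# 1)) (lookupV xs (# 2))) → Computable 3 (f $ⁿ_)
uncurry-computable₃ c = computable-≗ c λ { (x ∷ y ∷ z ∷ []) → refl }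

+-computable : Computable 2 (_+_ $ⁿ_)
+-computable = primRec _ (π fz) (compose₁ suc-computable (π (# 1)))
  (λ { (y ∷ []) → refl }) (λ { x (y ∷ []) → refl })

*-computable : Computable 2 (_*_ $ⁿ_)
*-computable = primRec _ (const-computable 0) (compose₂ +-computable (π (# 2)) (π (# 1)))
  (λ { (y ∷ []) → refl }) (λ { x (y ∷ []) → refl })

2^-computable : Computable 1 ((2 ^_) $ⁿ_)
2^-computable = primRec _ (const-computable 1) (compose₂ *-computable (const-computable 2) (π (# 1)))
  (λ { [] → refl }) (λ { x [] → refl })

pred-computable : Computable 1 (pred $ⁿ_)
pred-computable = primRec _ (const-computable 0) (π fz) (λ { [] → refl }) (λ { x [] → refl })

∸-computable : Computable 2 (_∸_ $ⁿ_)
∸-computable = uncurry-computable₂ (compose₂ flipped (π (# 1)) (π fz))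
  where
  flipped : Computable 2 ((λ n m → m ∸ n) $ⁿ_)
  flipped = primRec _ (π fz) (compose₁ pred-computable (π (# 1)))
    (λ { (m ∷ []) → refl }) (λ { n (m ∷ []) → sym (pred[m∸n]≡m∸[1+n] m n) })

⟨,⟩-computable : Computable 2 (⟨_,_⟩ $ⁿ_)
⟨,⟩-computable = uncurry-computable₂
  (compose₂ *-computable (compose₁ 2^-computable (π fz))
                         (compose₁ suc-computable (compose₂ *-computable (const-computable 2) (π (# 1)))))

ifZero : ℕ → ℕ → ℕ → ℕ
ifZero zero    a b = a
ifZero (suc _) a b = b

ifZero-computable : Computable 3 (ifZero $ⁿ_)
ifZero-computable = primRec _ (π fz) (π (# 3))
  (λ { (a ∷ b ∷ []) → refl }) (λ { x (a ∷ b ∷ []) → refl })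

foldr-concatMap : {A B C : Set} (f : B → C → C) (b : C) (g : A → List B) (xs : List A) →
                  foldr f b (concatMap g xs) ≡ foldr (λ x acc → foldr f acc (g x)) b xs
foldr-concatMap f b g []       = refl
foldr-concatMap f b g (x ∷ xs) =
  trans (foldr-++ f b (g x) (concatMap g xs)) (cong (λ acc → foldr f acc (g x)) (foldr-concatMap f b g xs))

tabulate-∘toℕ : {A : Set} (n : ℕ) (f : ℕ → A) → tabulate {n = n} (f ∘ toℕ) ≡ applyUpTo f n
tabulate-∘toℕ zero    f = refl
tabulate-∘toℕ (suc n) f = cong (f 0 ∷_) (tabulate-∘toℕ n (f ∘ suc))

foldr-allFin : {B : Set} (n : ℕ) (G : ℕ → B → B) (b : B) →
               foldr (λ i → G (toℕ i)) b (allFin n) ≡ foldr G b (upTo n)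
foldr-allFin n G b = begin
  foldr (λ i → G (toℕ i)) b (allFin n)       ≡⟨ foldr-map G toℕ b (allFin n) ⟨
  foldr G b (List.map toℕ (allFin n))        ≡⟨ cong (foldr G b) (map-tabulate {n = n} id toℕ) ⟩
  foldr G b (tabulate {n = n} toℕ)           ≡⟨ cong (foldr G b) (tabulate-∘toℕ n id) ⟩
  foldr G b (upTo n)                         ∎
  where open ≡-Reasoning

-- The fold of the last d elements of upTo N: primitive recursion builds a right fold from its innermost
-- element outwards.
foldrTail : {A : Set} → (ℕ → A → A) → A → ℕ → ℕ → A
foldrTail f b N zero    = b
foldrTail f b N (suc d) = f (N ∸ suc d) (foldrTail f b N d)

applyUpTo-cong : {A : Set} {f g : ℕ → A} → (∀ i → f i ≡ g i) → ∀ n → applyUpTo f n ≡ applyUpTo g n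
applyUpTo-cong f≗g zero    = refl
applyUpTo-cong f≗g (suc n) = cong₂ _∷_ (f≗g 0) (applyUpTo-cong (f≗g ∘ suc) n)

foldrTail-applyUpTo : {A : Set} (f : ℕ → A → A) (b : A) {N d : ℕ} → d ≤ N →
                      foldrTail f b N d ≡ foldr f b (applyUpTo (N ∸ d +_) d)
foldrTail-applyUpTo f b {d = zero}    _    = refl
foldrTail-applyUpTo f b {N} {suc d} d<N = cong₂ f (sym (+-identityʳ (N ∸ suc d)))
  (trans (foldrTail-applyUpTo f b (<⇒≤ d<N)) (cong (foldr f b) (applyUpTo-cong shift d)))
  where
  shift : ∀ i → N ∸ d + i ≡ N ∸ suc d + suc i
  shift i = trans (cong (_+ i) (+-∸-assoc 1 d<N)) (sym (+-suc (N ∸ suc d) i))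

foldrTail-upTo : {A : Set} (f : ℕ → A → A) (b : A) (N : ℕ) → foldrTail f b N N ≡ foldr f b (upTo N)
foldrTail-upTo f b N = trans (foldrTail-applyUpTo f b {N} ≤-refl)
  (cong (λ s → foldr f b (applyUpTo (s +_) N)) (n∸n≡0 N))

foldr-upTo-computable : {F : ℕ → ℕ → ℕ → ℕ} → Computable 3 (F $ⁿ_) →
                        Computable 3 ((λ p N b → foldr (F p) b (upTo N)) $ⁿ_)
foldr-upTo-computable {F} cF =
  computable-≗ (compose tail-computable (π (# 1) ∷ π (# 2) ∷ π (# 1) ∷ π fz ∷ []))
    λ { (p ∷ N ∷ b ∷ []) → foldrTail-upTo (F p) b N }
  where
  tail : Vec ℕ 4 → ℕ
  tail (d ∷ b ∷ N ∷ p ∷ []) = foldrTail (F p) b N d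
  tail-computable : Computable 4 tail
  tail-computable = primRec tail (π fz)
    (compose₃ cF (π (# 4)) (compose₂ ∸-computable (π (# 3)) (compose₁ suc-computable (π fz))) (π (# 1)))
    (λ { (b ∷ N ∷ p ∷ []) → refl }) (λ { d (b ∷ N ∷ p ∷ []) → refl })

-- Gödel numbers of formulas

-- Gödel numbers are astronomically large: keeping `code` and the pairing-based constructors opaque
-- makes the typechecker compare formulas instead of normalising numbers.
opaque
  code : ∀ {n} → Formula n → ℕ
  code = ⌜_⌝

  ⌜⌝≡code : ∀ {n} (φ : Formula n) → ⌜ φ ⌝ ≡ code φ
  ⌜⌝≡code φ = refl

  ⌜≐⌝ ⌜E⌝ ⌜⇒⌝ : ℕ → ℕ → ℕ
  ⌜≐⌝ a b = ⟨ 0 , ⟨ a , b ⟩ ⟩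
  ⌜E⌝ a b = ⟨ 1 , ⟨ a , b ⟩ ⟩
  ⌜⇒⌝ a b = ⟨ 3 , ⟨ a , b ⟩ ⟩

  ⌜⊥⌝ : ℕ
  ⌜⊥⌝ = ⟨ 2 , 0 ⟩

  ⌜∀⌝ : ℕ → ℕ
  ⌜∀⌝ a = ⟨ 4 , a ⟩

  code-≐ : ∀ {n} (a b : Fin n) → code (a ≐ b) ≡ ⌜≐⌝ (toℕ a) (toℕ b)
  code-≐ a b = refl

  code-E : ∀ {n} (a b : Fin n) → code (E a b) ≡ ⌜E⌝ (toℕ a) (toℕ b)
  code-E a b = refl

  code-⇒ : ∀ {n} (φ ψ : Formula n) → code (φ ⇒ ψ) ≡ ⌜⇒⌝ (code φ) (code ψ)
  code-⇒ φ ψ = refl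

  code-⊥ : ∀ {n} → code (⊥' {n}) ≡ ⌜⊥⌝
  code-⊥ = refl

  code-∀ : ∀ {n} (φ : Formula (suc n)) → code (∀' φ) ≡ ⌜∀⌝ (code φ)
  code-∀ φ = refl

  tagged-computable : ∀ t → Computable 2 ((λ a b → ⟨ t , ⟨ a , b ⟩ ⟩) $ⁿ_)
  tagged-computable t = uncurry-computable₂
    (compose₂ ⟨,⟩-computable (const-computable t) (compose₂ ⟨,⟩-computable (π fz) (π (# 1))))

  ⌜≐⌝-computable : Computable 2 (⌜≐⌝ $ⁿ_)
  ⌜≐⌝-computable = tagged-computable 0

  ⌜E⌝-computable : Computable 2 (⌜E⌝ $ⁿ_)
  ⌜E⌝-computable = tagged-computable 1

  ⌜⇒⌝-computable : Computable 2 (⌜⇒⌝ $ⁿ_)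
  ⌜⇒⌝-computable = tagged-computable 3

  ⌜∀⌝-computable : Computable 1 (⌜∀⌝ $ⁿ_)
  ⌜∀⌝-computable = uncurry-computable₁ (compose₂ ⟨,⟩-computable (const-computable 4) (π fz))

⌜¬⌝ ⌜∃⌝ : ℕ → ℕ
⌜¬⌝ a = ⌜⇒⌝ a ⌜⊥⌝
⌜∃⌝ a = ⌜¬⌝ (⌜∀⌝ (⌜¬⌝ a))

⌜⊤⌝ : ℕ
⌜⊤⌝ = ⌜⇒⌝ ⌜⊥⌝ ⌜⊥⌝

⌜∧⌝ ⌜≠⌝ : ℕ → ℕ → ℕ
⌜∧⌝ a b = ⌜¬⌝ (⌜⇒⌝ a (⌜¬⌝ b))
⌜≠⌝ a b = ⌜¬⌝ (⌜≐⌝ a b)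

⌜∃^⌝ : ℕ → ℕ → ℕ
⌜∃^⌝ zero    a = a
⌜∃^⌝ (suc k) a = ⌜∃^⌝ k (⌜∃⌝ a)

code-¬ : ∀ {n} (φ : Formula n) → code (¬' φ) ≡ ⌜¬⌝ (code φ)
code-¬ {n} φ = trans (code-⇒ φ ⊥') (cong (⌜⇒⌝ (code φ)) (code-⊥ {n}))

code-⊤ : ∀ {n} → code (⊤' {n}) ≡ ⌜⊤⌝
code-⊤ {n} = trans (code-⇒ {n} ⊥' ⊥') (cong₂ ⌜⇒⌝ (code-⊥ {n}) (code-⊥ {n}))

code-∧ : ∀ {n} (φ ψ : Formula n) → code (φ ∧' ψ) ≡ ⌜∧⌝ (code φ) (code ψ)
code-∧ φ ψ = trans (code-¬ (φ ⇒ ¬' ψ))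
  (cong ⌜¬⌝ (trans (code-⇒ φ (¬' ψ)) (cong (⌜⇒⌝ (code φ)) (code-¬ ψ))))

code-∃ : ∀ {n} (φ : Formula (suc n)) → code (∃' φ) ≡ ⌜∃⌝ (code φ)
code-∃ φ = trans (code-¬ (∀' (¬' φ))) (cong ⌜¬⌝ (trans (code-∀ (¬' φ)) (cong ⌜∀⌝ (code-¬ φ))))

code-≠ : ∀ {n} (a b : Fin n) → code (¬' (a ≐ b)) ≡ ⌜≠⌝ (toℕ a) (toℕ b)
code-≠ a b = trans (code-¬ (a ≐ b)) (cong ⌜¬⌝ (code-≐ a b))

code-∃^ : ∀ k {m} (φ : Formula (k + m)) → code (∃^ k φ) ≡ ⌜∃^⌝ k (code φ)
code-∃^ zero    φ = refl
code-∃^ (suc k) φ = trans (code-∃^ k (∃' φ)) (cong (⌜∃^⌝ k) (code-∃ φ))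

⌜¬⌝-computable : Computable 1 (⌜¬⌝ $ⁿ_)
⌜¬⌝-computable = uncurry-computable₁ (compose₂ ⌜⇒⌝-computable (π fz) (const-computable ⌜⊥⌝))

⌜∃⌝-computable : Computable 1 (⌜∃⌝ $ⁿ_)
⌜∃⌝-computable = uncurry-computable₁
  (compose₁ ⌜¬⌝-computable (compose₁ ⌜∀⌝-computable (compose₁ ⌜¬⌝-computable (π fz))))

⌜∧⌝-computable : Computable 2 (⌜∧⌝ $ⁿ_)
⌜∧⌝-computable = uncurry-computable₂
  (compose₁ ⌜¬⌝-computable (compose₂ ⌜⇒⌝-computable (π fz) (compose₁ ⌜¬⌝-computable (π (# 1)))))

⌜≠⌝-computable : Computable 2 (⌜≠⌝ $ⁿ_)
⌜≠⌝-computable = uncurry-computable₂ (compose₁ ⌜¬⌝-computable (compose₂ ⌜≐⌝-computable (π fz) (π (# 1))))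

⌜∃^⌝-suc : ∀ k a → ⌜∃^⌝ (suc k) a ≡ ⌜∃⌝ (⌜∃^⌝ k a)
⌜∃^⌝-suc zero    a = refl
⌜∃^⌝-suc (suc k) a = ⌜∃^⌝-suc k (⌜∃⌝ a)

⌜∃^⌝-computable : Computable 2 (⌜∃^⌝ $ⁿ_)
⌜∃^⌝-computable = primRec _ (π fz) (compose₁ ⌜∃⌝-computable (π (# 1)))
  (λ { (a ∷ []) → refl }) (λ { k (a ∷ []) → ⌜∃^⌝-suc k a })

code-⋀ : ∀ {n} (L : List (Formula n)) → code (⋀ L) ≡ foldr (λ φ → ⌜∧⌝ (code φ)) ⌜⊤⌝ L
code-⋀ {n} []      = code-⊤ {n}
code-⋀     (φ ∷ L) = trans (code-∧ φ (⋀ L)) (cong (⌜∧⌝ (code φ)) (code-⋀ L))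

-- suc i ∸ j is zero exactly when i < j, the comparison made by `pairwise`.
guarded∧ : (ℕ → ℕ → ℕ) → ℕ → ℕ → ℕ → ℕ
guarded∧ r i j acc = ifZero (suc i ∸ j) (⌜∧⌝ (r i j) acc) acc

⌜pairwise⌝ : (ℕ → ℕ → ℕ) → ℕ → ℕ
⌜pairwise⌝ r k = foldr (λ i acc → foldr (guarded∧ r i) acc (upTo k)) ⌜⊤⌝ (upTo k)

code-⋀-concatMap² : ∀ {n k} (P : Fin k → Fin k → List (Formula n)) (G : ℕ → ℕ → ℕ → ℕ) →
  (∀ i j acc → foldr (λ φ → ⌜∧⌝ (code φ)) acc (P i j) ≡ G (toℕ i) (toℕ j) acc) →
  code (⋀ (concatMap (λ i → concatMap (P i) (allFin k)) (allFin k))) ≡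
  foldr (λ i acc → foldr (G i) acc (upTo k)) ⌜⊤⌝ (upTo k)
code-⋀-concatMap² {k = k} P G P≗G = begin
  code (⋀ (concatMap (λ i → concatMap (P i) all) all))
    ≡⟨ code-⋀ (concatMap (λ i → concatMap (P i) all) all) ⟩
  foldr ∧φ ⌜⊤⌝ (concatMap (λ i → concatMap (P i) all) all)
    ≡⟨ foldr-concatMap ∧φ ⌜⊤⌝ _ all ⟩
  foldr (λ i acc → foldr ∧φ acc (concatMap (P i) all)) ⌜⊤⌝ all
    ≡⟨ foldr-cong (λ i acc → foldr-concatMap ∧φ acc (P i) all) refl all ⟩
  foldr (λ i acc → foldr (λ j acc′ → foldr ∧φ acc′ (P i j)) acc all) ⌜⊤⌝ all
    ≡⟨ foldr-cong (λ i acc → foldr-cong (P≗G i) refl all) refl all ⟩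
  foldr (λ i acc → foldr (λ j → G (toℕ i) (toℕ j)) acc all) ⌜⊤⌝ all
    ≡⟨ foldr-cong (λ i acc → foldr-allFin k (G (toℕ i)) acc) refl all ⟩
  foldr (λ i acc → foldr (G (toℕ i)) acc (upTo k)) ⌜⊤⌝ all
    ≡⟨ foldr-allFin k (λ i acc → foldr (G i) acc (upTo k)) ⌜⊤⌝ ⟩
  foldr (λ i acc → foldr (G i) acc (upTo k)) ⌜⊤⌝ (upTo k)
    ∎
  where
  open ≡-Reasoning
  all = allFin k
  ∧φ : Formula _ → ℕ → ℕ
  ∧φ φ = ⌜∧⌝ (code φ)

-- The comparison helper of `pairwise` is local to its where-block; unification recovers it.
mutual
  pairwise-pick : ∀ {k} m → (Fin (k + m) → Fin (k + m) → Formula (k + m)) →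
                  Fin k → Fin k → List (Formula (k + m))
  pairwise-pick m R = _

  pairwise-unfold : ∀ {k} m R →
    pairwise {k} m R ≡ ⋀ (concatMap (λ i → concatMap (pairwise-pick m R i) (allFin k)) (allFin k))
  pairwise-unfold m R = refl

code-pairwise-pick : ∀ {k} m R (r : ℕ → ℕ → ℕ) → (∀ a b → code (R a b) ≡ r (toℕ a) (toℕ b)) →
  ∀ (i j : Fin k) acc →
  foldr (λ φ → ⌜∧⌝ (code φ)) acc (pairwise-pick m R i j) ≡ guarded∧ r (toℕ i) (toℕ j) acc
code-pairwise-pick m R r R≗r i j acc with i <? j
... | yes i<j rewrite m≤n⇒m∸n≡0 i<j | R≗r (i ↑ˡ m) (j ↑ˡ m) | toℕ-↑ˡ i m | toℕ-↑ˡ j m = refl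
... | no i≮j rewrite +-∸-assoc 1 (≮⇒≥ i≮j) = refl

code-pairwise : ∀ {k} m R (r : ℕ → ℕ → ℕ) → (∀ a b → code (R a b) ≡ r (toℕ a) (toℕ b)) →
                code (pairwise {k} m R) ≡ ⌜pairwise⌝ r k
code-pairwise m R r R≗r = trans (cong code (pairwise-unfold m R))
  (code-⋀-concatMap² (pairwise-pick m R) (guarded∧ r) (code-pairwise-pick m R r R≗r))

⌜⋀E⌝ : ℕ → ℕ → ℕ
⌜⋀E⌝ c k = foldr (λ i → ⌜∧⌝ (⌜E⌝ c i)) ⌜⊤⌝ (upTo k)

code-⋀-allFin : ∀ {n k} (F : Fin k → Formula n) (c : ℕ → ℕ) → (∀ i → code (F i) ≡ c (toℕ i)) →
                code (⋀ (List.map F (allFin k))) ≡ foldr (λ i → ⌜∧⌝ (c i)) ⌜⊤⌝ (upTo k)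
code-⋀-allFin {k = k} F c F≗c = begin
  code (⋀ (List.map F (allFin k)))
    ≡⟨ code-⋀ (List.map F (allFin k)) ⟩
  foldr (λ φ → ⌜∧⌝ (code φ)) ⌜⊤⌝ (List.map F (allFin k))
    ≡⟨ foldr-map _ F ⌜⊤⌝ (allFin k) ⟩
  foldr (λ i → ⌜∧⌝ (code (F i))) ⌜⊤⌝ (allFin k)
    ≡⟨ foldr-cong (λ i acc → cong (λ a → ⌜∧⌝ a acc) (F≗c i)) refl (allFin k) ⟩
  foldr (λ i → ⌜∧⌝ (c (toℕ i))) ⌜⊤⌝ (allFin k)
    ≡⟨ foldr-allFin k (λ i → ⌜∧⌝ (c i)) ⌜⊤⌝ ⟩
  foldr (λ i → ⌜∧⌝ (c i)) ⌜⊤⌝ (upTo k)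
    ∎
  where open ≡-Reasoning

⌜atLeast⌝ : ℕ → ℕ → ℕ
⌜atLeast⌝ k x = ⌜∃^⌝ k (⌜∧⌝ (⌜pairwise⌝ ⌜≠⌝ k) (⌜⋀E⌝ (k + x) k))

code-atLeast : ∀ {m} k (x : Fin m) → code (atLeast k x) ≡ ⌜atLeast⌝ k (toℕ x)
code-atLeast {m} k x =
  trans (code-∃^ k (distinct ∧' sameClass)) (cong (⌜∃^⌝ k)
    (trans (code-∧ distinct sameClass) (cong₂ ⌜∧⌝ code-distinct code-sameClass)))
  where
  distinct sameClass : Formula (k + m)
  distinct  = pairwise m (λ a b → ¬' (a ≐ b))
  sameClass = ⋀ (List.map (λ i → E (k ↑ʳ x) (y m i)) (allFin k))
  code-distinct : code distinct ≡ ⌜pairwise⌝ ⌜≠⌝ k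
  code-distinct = code-pairwise {k} m (λ a b → ¬' (a ≐ b)) ⌜≠⌝ code-≠
  code-sameClass : code sameClass ≡ ⌜⋀E⌝ (k + toℕ x) k
  code-sameClass = code-⋀-allFin (λ i → E (k ↑ʳ x) (y m i)) (⌜E⌝ (k + toℕ x)) λ i →
    trans (code-E (k ↑ʳ x) (y m i)) (cong₂ ⌜E⌝ (toℕ-↑ʳ k x) (toℕ-↑ˡ i m))

⌜Φ⌝ : ℕ → ℕ
⌜Φ⌝ n = ⌜∃⌝ (⌜∧⌝ (⌜atLeast⌝ (suc n) 0) (⌜¬⌝ (⌜atLeast⌝ (suc (suc n)) 0)))

code-Φ : ∀ n → code (Φ n) ≡ ⌜Φ⌝ n
code-Φ n = trans (code-∃ (atLeast₁ ∧' ¬' atLeast₂)) (cong ⌜∃⌝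
  (trans (code-∧ atLeast₁ (¬' atLeast₂)) (cong₂ ⌜∧⌝ (code-atLeast (suc n) v0)
    (trans (code-¬ atLeast₂) (cong ⌜¬⌝ (code-atLeast (suc (suc n)) v0))))))
  where
  atLeast₁ atLeast₂ : Formula 1
  atLeast₁ = atLeast (suc n) v0
  atLeast₂ = atLeast (suc (suc n)) v0

guarded∧-computable : {r : ℕ → ℕ → ℕ} → Computable 2 (r $ⁿ_) → Computable 3 (guarded∧ r $ⁿ_)
guarded∧-computable cr = uncurry-computable₃
  (compose₃ ifZero-computable (compose₂ ∸-computable (compose₁ suc-computable (π fz)) (π (# 1)))
                              (compose₂ ⌜∧⌝-computable (compose₂ cr (π fz) (π (# 1))) (π (# 2)))
                              (π (# 2)))

⌜pairwise⌝-computable : {r : ℕ → ℕ → ℕ} → Computable 2 (r $ⁿ_) → Computable 1 (⌜pairwise⌝ r $ⁿ_)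
⌜pairwise⌝-computable {r} cr = uncurry-computable₁
  (compose₃ (foldr-upTo-computable row) (π fz) (π fz) (const-computable ⌜⊤⌝))
  where
  row : Computable 3 ((λ k i acc → foldr (guarded∧ r i) acc (upTo k)) $ⁿ_)
  row = uncurry-computable₃
    (compose₃ (foldr-upTo-computable (guarded∧-computable cr)) (π (# 1)) (π fz) (π (# 2)))

⌜⋀E⌝-computable : Computable 2 (⌜⋀E⌝ $ⁿ_)
⌜⋀E⌝-computable = uncurry-computable₂
  (compose₃ (foldr-upTo-computable conjunct) (π fz) (π (# 1)) (const-computable ⌜⊤⌝))
  where
  conjunct : Computable 3 ((λ c i → ⌜∧⌝ (⌜E⌝ c i)) $ⁿ_)
  conjunct = uncurry-computable₃
    (compose₂ ⌜∧⌝-computable (compose₂ ⌜E⌝-computable (π fz) (π (# 1))) (π (# 2)))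

⌜atLeast⌝-computable : Computable 2 (⌜atLeast⌝ $ⁿ_)
⌜atLeast⌝-computable = uncurry-computable₂
  (compose₂ ⌜∃^⌝-computable (π fz)
    (compose₂ ⌜∧⌝-computable (compose₁ (⌜pairwise⌝-computable ⌜≠⌝-computable) (π fz))
                             (compose₂ ⌜⋀E⌝-computable (compose₂ +-computable (π fz) (π (# 1))) (π fz))))

⌜Φ⌝-computable : Computable 1 (⌜Φ⌝ $ⁿ_)
⌜Φ⌝-computable = uncurry-computable₁
  (compose₁ ⌜∃⌝-computable
    (compose₂ ⌜∧⌝-computable
      (compose₂ ⌜atLeast⌝-computable (compose₁ suc-computable (π fz)) (const-computable 0))
      (compose₁ ⌜¬⌝-computable
        (compose₂ ⌜atLeast⌝-computable (compose₁ suc-computable (compose₁ suc-computable (π fz)))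
                                       (const-computable 0)))))

code-Φ-computable : Computable 1 ((⌜_⌝ ∘ Φ) $ⁿ_)
code-Φ-computable = computable-≗ ⌜Φ⌝-computable λ { (n ∷ []) → sym (trans (⌜⌝≡code (Φ n)) (code-Φ n)) }

-- Effective inseparability along computable reductions

W-precompose : ∀ {f} (cf : Computable 1 (f $ⁿ_)) (i : PR 1) {x} →
               W i (f x) → W (comp i (program cf ∷ [])) x
W-precompose cf i {x} (w , run) = w , comp-⇓ (∷-⇓* {gs = []} (computes cf (x ∷ [])) ([]-⇓* (x ∷ []))) run

W-precompose⁻¹ : ∀ {f} (cf : Computable 1 (f $ⁿ_)) (i : PR 1) {x} →
                 W (comp i (program cf ∷ [])) x → W i (f x)
W-precompose⁻¹ cf i {x} (w , run) with comp-⇓⁻¹ run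
... | a ∷ [] , g-run , i-run =
  w , subst (λ a → i ⇓ (a ∷ []) ⇒ w) (⇓-functional ([-]-⇓*⁻¹ g-run) (computes cf (x ∷ []))) i-run

opaque
  precompose-index : PR 1 → ℕ → ℕ
  precompose-index g e = ⟨ 3 , ⟨ 1 , ⟨ e , codeVec (g ∷ []) ⟩ ⟩ ⟩

  precompose-index-correct : ∀ g i → precompose-index g ⌜ i ⌝ₚ ≡ ⌜ comp i (g ∷ []) ⌝ₚ
  precompose-index-correct g i = refl

  precompose-index-computable : ∀ g → Computable 1 (precompose-index g $ⁿ_)
  precompose-index-computable g = uncurry-computable₁
    (compose₂ ⟨,⟩-computable (const-computable 3) (compose₂ ⟨,⟩-computable (const-computable 1)
      (compose₂ ⟨,⟩-computable (π fz) (const-computable (codeVec (g ∷ []))))))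

EI-reduction : {Y Z A B : ℕ → Set} (f : ℕ → ℕ) → Computable 1 (f $ⁿ_) →
               (∀ n → Y n → A (f n)) → (∀ n → Z n → B (f n)) → EI Y Z → EI A B
EI-reduction {Y} {Z} {A} {B} f cf fY⊆A fZ⊆B (F , F-total , F-separates) =
  program G , (λ a b → _ , computes G (a ∷ b ∷ [])) , G-separates
  where
  g = program cf
  h = precompose-index g
  F-value : ℕ → ℕ → ℕ
  F-value a b = proj₁ (F-total a b)
  F-computable : Computable 2 (F-value $ⁿ_)
  F-computable = computable F λ { (a ∷ b ∷ []) → proj₂ (F-total a b) }
  G : Computable 2 (λ xs → f (F-value (h (lookupV xs fz)) (h (lookupV xs (# 1)))))
  G = compose₁ cf (compose₂ F-computable (compose₁ (precompose-index-computable g) (π fz))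
                                         (compose₁ (precompose-index-computable g) (π (# 1))))
  G-separates : ∀ i j → A ⊆ W i → B ⊆ W j → Disjoint (W i) (W j) →
                ∀ v → program G ⇓ (⌜ i ⌝ₚ ∷ ⌜ j ⌝ₚ ∷ []) ⇒ v → ¬ (W i v ⊎ W j v)
  G-separates i j A⊆Wi B⊆Wj Wi∩Wj=∅ v G-run v∈Wi∪Wj =
    F-separates i′ j′ Y⊆Wi′ Z⊆Wj′ Wi′∩Wj′=∅ u (proj₂ (F-total ⌜ i′ ⌝ₚ ⌜ j′ ⌝ₚ))
      (Sum.map (W-precompose cf i) (W-precompose cf j) (subst (λ v → W i v ⊎ W j v) v≡fu v∈Wi∪Wj))
    where
    i′ j′ : PR 1
    i′ = comp i (g ∷ [])
    j′ = comp j (g ∷ [])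
    Y⊆Wi′ : Y ⊆ W i′
    Y⊆Wi′ n = W-precompose cf i ∘ A⊆Wi (f n) ∘ fY⊆A n
    Z⊆Wj′ : Z ⊆ W j′
    Z⊆Wj′ n = W-precompose cf j ∘ B⊆Wj (f n) ∘ fZ⊆B n
    Wi′∩Wj′=∅ : Disjoint (W i′) (W j′)
    Wi′∩Wj′=∅ x x∈Wi′ x∈Wj′ = Wi∩Wj=∅ (f x) (W-precompose⁻¹ cf i x∈Wi′) (W-precompose⁻¹ cf j x∈Wj′)
    u = F-value ⌜ i′ ⌝ₚ ⌜ j′ ⌝ₚ
    v≡fu : v ≡ f u
    v≡fu = trans (⇓-functional G-run (computes G (⌜ i ⌝ₚ ∷ ⌜ j ⌝ₚ ∷ [])))
                 (cong₂ (λ a b → f (F-value a b)) (precompose-index-correct g i) (precompose-index-correct g j))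

⊩-axiom : ∀ {T : Sentence → Set} {φ} → T φ → T ⊩ φ
⊩-axiom Tφ = _ ∷ [] , Tφ ∷ [] , assum (here refl)

lemma4p29 : (y z : PR 1) → EI (W y) (W z) → EIₜ (VAx (W y) (W z))
lemma4p29 y z = EI-reduction (⌜_⌝ ∘ Φ) code-Φ-computable
  (λ n n∈Y → Φ n , refl , ⊩-axiom (pos n∈Y))
  (λ n n∈Z → Φ n , refl , ⊩-axiom (neg n∈Z))
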